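{- Let $(G=(V,E),c,k)$ be an instance of \textsc{ECS}, let $D\subseteq V$ be a saturated order-$c$ component cover of $G$, let $I:=V\setminus D$, and assume no connected component of $G$ is contained in $I$ and $|I|\ge c^2|D|$. Let $X\subseteq D$ and $Y\subseteq I$ be nonempty with $N(Y)\subseteq X\cup Y$ such that there exists $M\subseteq E(X,Y)$ where (a) every vertex of $X$ is incident with exactly $c$ edges of $M$ and (b) exactly $c|X|$ vertices of $Y$ are endpoints of edges in $M$ and every connected component of $G[Y]$ contains at most one such vertex. Then $(G,c,k)$ is a yes-instance if and only if $(G-(X\cup Y),\,c,\,k-|E_G(X,V)|+c\cdot|X|)$ is a yes-instance.
   Context: \textsc{ECS}: given a graph $G$ and integers $c,k$, decide whether $G$ has a proper $c$-colored labeling (partition of $E$ into $c$ strong classes, no two edges sharing an endpoint in the same strong class, and a weak class $W$) with $|W|\le k$. A set $D\subseteq V$ is an order-$c$ component cover if every connected component of $G-D$ has at most $c$ vertices; it is saturated if every $v\in D$ has a neighbor in $V\setminus D$. $E_G(A,B)$ is the set of edges $\{a,b\}\in E$ with $a\in A$, $b\in B$; $N(Y)=\bigcup_{y\in Y}N(y)$. -}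

module Defs where

open import Data.Nat using (ℕ; zero; suc; _+_; _*_; _≤_; _<ᵇ_)
open import Data.Bool using (Bool; true; false; _∧_; _∨_; if_then_else_; not)
open import Data.Fin using (Fin; toℕ)
open import Data.Fin.Subset using (Subset; _∈_; _∉_; _⊆_; ∁; _∪_; ∣_∣; Nonempty)
open import Data.Vec using (lookup)
open import Data.List using (List; map; allFin)
open import Data.Nat.ListAction using (sum)
open import Data.Maybe using (Maybe; just; nothing; is-nothing)
open import Data.Product using (Σ; ∃; _×_; _,_)
open import Data.Integer as ℤ using (ℤ; +_)
open import Relation.Binary.PropositionalEquality using (_≡_; _≢_)

record Graph : Set where
  field
    n     : ℕ
    adj   : Fin n → Fin n → Bool
    sym   : ∀ u v → adj u v ≡ adj v u
    irrefl : ∀ v → adj v v ≡ false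
open Graph public

countV : ∀ {n} → (Fin n → Bool) → ℕ
countV {n} p = sum (map (λ i → if p i then 1 else 0) (allFin n))

countPairs : ∀ {n} → (Fin n → Fin n → Bool) → ℕ
countPairs {n} p =
  sum (map (λ u → sum (map (λ v → if (toℕ u <ᵇ toℕ v) ∧ p u v then 1 else 0)
                            (allFin n)))
           (allFin n))

_∈ᵇ_ : ∀ {n} → Fin n → Subset n → Bool
v ∈ᵇ S = lookup S v

module _ (G : Graph) where

  data Conn (S : Subset (n G)) : Fin (n G) → Fin (n G) → Set where
    here : ∀ {v} → v ∈ S → Conn S v v
    step : ∀ {u v w} → u ∈ S → adj G u v ≡ true → Conn S v w → Conn S u w

  -- D is an order-c component cover: every connected component of G - D
  -- has at most c vertices
  OrderComponentCover : ℕ → Subset (n G) → Set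
  OrderComponentCover c D =
    ∀ v (T : Subset (n G)) → (∀ u → u ∈ T → Conn (∁ D) v u) → ∣ T ∣ ≤ c

  Saturated : Subset (n G) → Set
  Saturated D = ∀ v → v ∈ D → ∃ λ u → u ∉ D × adj G v u ≡ true

  edgeIn : Subset (n G) → Fin (n G) → Fin (n G) → Bool
  edgeIn S u v = (u ∈ᵇ S) ∧ (v ∈ᵇ S) ∧ adj G u v

  -- A proper c-colored labeling of G[S]: each edge {u,v} gets label
  -- L u v = L v u, either just i (strong class i) or nothing (weak class W);
  -- two distinct edges sharing an endpoint never share a strong class.
  record ProperLabeling (S : Subset (n G)) (c : ℕ) : Set where
    field
      L       : Fin (n G) → Fin (n G) → Maybe (Fin c)
      L-sym   : ∀ u v → edgeIn S u v ≡ true → L u v ≡ L v u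
      proper  : ∀ u v w (i : Fin c) →
                edgeIn S u v ≡ true → edgeIn S u w ≡ true →
                L u v ≡ just i → L u w ≡ just i → v ≡ w

    weakSize : ℕ
    weakSize = countPairs (λ u v → edgeIn S u v ∧ is-nothing (L u v))

  ECSYes : Subset (n G) → ℕ → ℤ → Set
  ECSYes S c k = Σ (ProperLabeling S c) λ ℓ → (+ ProperLabeling.weakSize ℓ) ℤ.≤ k

  edgesAt : Subset (n G) → ℕ
  edgesAt X = countPairs (λ u v → adj G u v ∧ ((u ∈ᵇ X) ∨ (v ∈ᵇ X)))

module Submission where

-- (⇒) Restrict a labeling of G.  The edges at X disappear; at most c|X| of
--     them are strong, because the strong edges at a vertex have distinct
--     colours (pigeonhole).
-- (⇐) Extend a labeling of G - (X ∪ Y).  Inside a component K of G[Y]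
--     (|K| ≤ c) colour {u , v} by (rank u + rank v + shift K) mod c; give
--     each covered y ∈ Y the edge to its first M-neighbour x, coloured by the
--     rank of y among the M-neighbours of x; leave all other edges at X weak.
--     The shift of K makes the colour missing at the unique covered vertex of
--     K the colour of its matching edge, and the c|X| matching edges pay for
--     the weak edges at X.

open import Defs hiding (sym)
open import Data.Nat using (ℕ; zero; suc; _+_; _*_; _∸_; _≤_; _<_; _≥_; _<ᵇ_; z≤n; s≤s; NonZero; >-nonZero)
open import Data.Nat.Properties
  using (≤-refl; ≤-trans; ≤-reflexive; ≤-antisym; <-irrefl; <-asym; <-trans; <-cmp; <⇒≤; <ᵇ⇒<; <⇒<ᵇ;
         +-mono-≤; +-monoʳ-≤; +-monoˡ-≤; +-cancelʳ-≤; +-comm; +-assoc; +-suc; *-identityʳ; m≤n+m; m+[n∸m]≡n;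
         +-*-semiring; module ≤-Reasoning)
open import Data.Nat.DivMod
  using (_%_; _/_; _mod_; %-distribˡ-+; m%n%n≡m%n; %-remove-+ʳ; m<n⇒m%n≡m; m≡m%n+[m/n]*n; m%n<n; [m+n]%n≡m%n)
open import Data.Nat.Divisibility using (divides)
open import Data.Nat.GeneralisedArithmetic using (fold)
open import Data.Nat.ListAction using (sum)
open import Data.Nat.Solver renaming (module +-*-Solver to ℕ-Solver)
open import Data.Integer as ℤ using (ℤ; +_; +≤+)
import Data.Integer.Properties as ℤ
open import Data.Integer.Solver renaming (module +-*-Solver to ℤ-Solver)
open import Data.Bool using (Bool; true; false; _∧_; _∨_; not; if_then_else_)
open import Data.Bool.Properties
  using (T-≡; ∧-conicalˡ; ∧-conicalʳ; ∧-zeroʳ; ∨-zeroʳ; ∧-identityʳ; ∧-comm; ∧-distribˡ-∨)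
  renaming (_≟_ to _≟ᵇ_)
open import Data.Fin using (Fin; zero; suc; toℕ)
open import Data.Fin.Properties using (_≟_; toℕ-injective; suc-injective; toℕ-fromℕ<; any?)
open import Data.Fin.Subset using (Subset; _∈_; _∉_; _⊆_; ∁; _∪_; ∣_∣; Nonempty; ⊤; ⁅_⁆)
open import Data.Fin.Subset.Properties using (∣⁅x⁆∣≡1; x∈⁅y⁆⇒x≡y; x∉p⇒x∈∁p; x∈∁p⇒x∉p)
open import Data.Vec using ([]; _∷_; tabulate)
open import Data.Vec.Properties
  using ([]=⇒lookup; lookup⇒[]=; lookup-replicate; lookup-map; lookup-zipWith; lookup∘tabulate)
open import Data.List as List using (List; []; _∷_; map; allFin; findᵇ)
open import Data.List.Properties using (map-tabulate)
open import Data.List.Membership.Propositional using (find; lose)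
open import Data.List.Membership.Propositional.Properties using (∈-allFin)
open import Data.List.Relation.Unary.Any.Properties using (any⁺; any⁻)
open import Data.Bool.ListAction using (any)
open import Data.Maybe using (Maybe; just; nothing; is-just; is-nothing; maybe′)
open import Data.Maybe.Properties using (just-injective)
open import Data.Product using (Σ; ∃; _×_; _,_; proj₁; proj₂)
open import Data.Sum using (_⊎_; inj₁; inj₂)
open import Data.Empty using (⊥; ⊥-elim)
open import Function.Bundles using (Equivalence; _⇔_; mk⇔)
open import Relation.Nullary using (does; yes; no; ¬_; _×-dec_)
open import Relation.Binary.Definitions using (tri<; tri≈; tri>)
open import Relation.Binary.PropositionalEquality
  using (_≡_; refl; sym; trans; cong; cong₂; subst; subst₂; module ≡-Reasoning)
open import Algebra.Properties.Semiring.Sum +-*-semiring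
  using (sum-cong-≗; ∑-distrib-+; ∑-comm; *-distribˡ-sum) renaming (sum to ∑)

_⊆ᵇ_ : ∀ {n} → (Fin n → Bool) → (Fin n → Bool) → Set
p ⊆ᵇ q = ∀ i → p i ≡ true → q i ≡ true

true≢false : true ≡ false → ⊥
true≢false ()

∧-elimˡ : ∀ {a b} → a ∧ b ≡ true → a ≡ true
∧-elimˡ {a} {b} = ∧-conicalˡ a b

∧-elimʳ : ∀ {a b} → a ∧ b ≡ true → b ≡ true
∧-elimʳ {a} {b} = ∧-conicalʳ a b

∨-introˡ : ∀ {a b} → a ≡ true → a ∨ b ≡ true
∨-introˡ refl = refl

∨-introʳ : ∀ {a b} → b ≡ true → a ∨ b ≡ true
∨-introʳ {a} refl = ∨-zeroʳ a

∧-intro : ∀ {a b} → a ≡ true → b ≡ true → a ∧ b ≡ true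
∧-intro refl refl = refl

∧≡false⇒ : ∀ {a b} → (a ≡ true → b ≡ true) → a ∧ b ≡ false → a ≡ false
∧≡false⇒ {false} _ _ = refl
∧≡false⇒ {true}  f h = ⊥-elim (true≢false (trans (sym (f refl)) h))

bool-ext : ∀ {a b} → (a ≡ true → b ≡ true) → (b ≡ true → a ≡ true) → a ≡ b
bool-ext {false} {false} _ _ = refl
bool-ext {false} {true}  _ g = g refl
bool-ext {true}           f _ = sym (f refl)

∑-mono : ∀ {n} {f g : Fin n → ℕ} → (∀ i → f i ≤ g i) → ∑ f ≤ ∑ g
∑-mono {zero}  _ = z≤n
∑-mono {suc n} h = +-mono-≤ (h zero) (∑-mono (λ i → h (suc i)))

ind : Bool → ℕ
ind b = if b then 1 else 0

count : ∀ {n} → (Fin n → Bool) → ℕ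
count p = ∑ (λ i → ind (p i))

ind-mono : ∀ {a b} → (a ≡ true → b ≡ true) → ind a ≤ ind b
ind-mono {false} _ = z≤n
ind-mono {true}  h rewrite h refl = ≤-refl

count-cong : ∀ {n} {p q : Fin n → Bool} → (∀ i → p i ≡ q i) → count p ≡ count q
count-cong h = sum-cong-≗ (λ i → cong ind (h i))

count-mono : ∀ {n} {p q : Fin n → Bool} → p ⊆ᵇ q → count p ≤ count q
count-mono h = ∑-mono (λ i → ind-mono (h i))

count-false : ∀ {n} → count {n} (λ _ → false) ≡ 0
count-false {zero}  = refl
count-false {suc n} = count-false {n}

count-true : ∀ {n} → count {n} (λ _ → true) ≡ n
count-true {zero}  = refl
count-true {suc n} = cong suc (count-true {n})

count-≤ : ∀ {n} (p : Fin n → Bool) → count p ≤ n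
count-≤ {n} p =
  ≤-trans (count-mono {p = p} {q = λ _ → true} (λ _ _ → refl)) (≤-reflexive (count-true {n}))

count-∨ : ∀ {n} (p q : Fin n → Bool) → count (λ i → p i ∨ q i) ≤ count p + count q
count-∨ p q = ≤-trans (∑-mono (λ i → ind-∨ (p i) (q i)))
                      (≤-reflexive (∑-distrib-+ (λ i → ind (p i)) (λ i → ind (q i))))
  where
  ind-∨ : ∀ a b → ind (a ∨ b) ≤ ind a + ind b
  ind-∨ false b = ≤-refl
  ind-∨ true  b = s≤s z≤n

count-disjoint : ∀ {n} (p q : Fin n → Bool) → (∀ i → p i ≡ true → q i ≡ false) →
                 count p + count q ≤ count (λ i → p i ∨ q i)
count-disjoint p q disj =
  ≤-trans (≤-reflexive (sym (∑-distrib-+ (λ i → ind (p i)) (λ i → ind (q i)))))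
          (∑-mono (λ i → ind-disj (disj i)))
  where
  ind-disj : ∀ {a b} → (a ≡ true → b ≡ false) → ind a + ind b ≤ ind (a ∨ b)
  ind-disj {false} _ = ≤-refl
  ind-disj {true}  h rewrite h refl = ≤-refl

count-strict : ∀ {n} {p q : Fin n → Bool} → p ⊆ᵇ q → ∀ a → q a ≡ true → p a ≡ false →
               suc (count p) ≤ count q
count-strict {suc n} {p} {q} p⊆q zero qa pa rewrite qa | pa =
  s≤s (count-mono (λ i → p⊆q (suc i)))
count-strict {suc n} {p} {q} p⊆q (suc a) qa pa =
  ≤-trans (≤-reflexive (sym (+-suc (ind (p zero)) _)))
          (+-mono-≤ (ind-mono (p⊆q zero)) (count-strict (λ i → p⊆q (suc i)) a qa pa))

count-≥1 : ∀ {n} {p : Fin n → Bool} a → p a ≡ true → 1 ≤ count p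
count-≥1 {n} a pa =
  ≤-trans (s≤s (≤-reflexive (sym (count-false {n})))) (count-strict {p = λ _ → false} (λ _ ()) a pa refl)

count-atMostOne : ∀ {n} (p : Fin n → Bool) → (∀ a b → p a ≡ true → p b ≡ true → a ≡ b) →
                  count p ≤ 1
count-atMostOne {zero}  p uniq = z≤n
count-atMostOne {suc n} p uniq with p zero in p0
... | true  = s≤s (≤-reflexive (trans (count-cong rest-false) (count-false {n})))
  where
  rest-false : ∀ i → p (suc i) ≡ false
  rest-false i with p (suc i) in pi
  ... | false = refl
  ... | true with uniq zero (suc i) p0 pi
  ... | ()
... | false = count-atMostOne (λ i → p (suc i))
                (λ a b pa pb → suc-injective (uniq (suc a) (suc b) pa pb))

_≺_ : ∀ {n} → Fin n → Fin n → Bool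
u ≺ v = toℕ u <ᵇ toℕ v

≺⇒< : ∀ {n} (u v : Fin n) → (u ≺ v) ≡ true → toℕ u < toℕ v
≺⇒< u v h = <ᵇ⇒< (toℕ u) (toℕ v) (Equivalence.from T-≡ h)

<⇒≺ : ∀ {n} (u v : Fin n) → toℕ u < toℕ v → (u ≺ v) ≡ true
<⇒≺ u v lt = Equivalence.to T-≡ (<⇒<ᵇ lt)

≺-irrefl : ∀ {n} (u : Fin n) → (u ≺ u) ≡ false
≺-irrefl u with u ≺ u in eq
... | false = refl
... | true  = ⊥-elim (<-irrefl refl (≺⇒< u u eq))

≺-asym : ∀ {n} {u v : Fin n} → (u ≺ v) ≡ true → (v ≺ u) ≡ false
≺-asym {u = u} {v} uv with v ≺ u in vu
... | false = refl
... | true  = ⊥-elim (<-asym (≺⇒< u v uv) (≺⇒< v u vu))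

≺-connex : ∀ {n} {u v : Fin n} → ¬ u ≡ v → (u ≺ v) ∨ (v ≺ u) ≡ true
≺-connex {u = u} {v} u≢v with <-cmp (toℕ u) (toℕ v)
... | tri< lt _ _ rewrite <⇒≺ u v lt = refl
... | tri≈ _ eq _ = ⊥-elim (u≢v (toℕ-injective eq))
... | tri> _ _ gt rewrite <⇒≺ v u gt = ∨-zeroʳ (u ≺ v)

rank : ∀ {n} → (Fin n → Bool) → Fin n → ℕ
rank p a = count (λ w → p w ∧ (w ≺ a))

rank-cong : ∀ {n} {p q : Fin n → Bool} a → (∀ w → p w ≡ q w) → rank p a ≡ rank q a
rank-cong a h = count-cong (λ w → cong (_∧ (w ≺ a)) (h w))

rank-< : ∀ {n} (p : Fin n → Bool) {a} → p a ≡ true → rank p a < count p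
rank-< p {a} pa =
  count-strict {p = λ w → p w ∧ (w ≺ a)} (λ w → ∧-elimˡ {p w}) a pa
               (trans (cong (p a ∧_) (≺-irrefl a)) (∧-zeroʳ (p a)))

rank-strict : ∀ {n} (p : Fin n → Bool) {a b} → p a ≡ true → (a ≺ b) ≡ true → rank p a < rank p b
rank-strict p {a} {b} pa ab =
  count-strict {p = λ w → p w ∧ (w ≺ a)} {q = λ w → p w ∧ (w ≺ b)}
               (λ w h → ∧-intro {p w} (∧-elimˡ {p w} h)
                          (<⇒≺ w b (<-trans (≺⇒< w a (∧-elimʳ {p w} h)) (≺⇒< a b ab))))
               a (∧-intro {p a} pa ab) (trans (cong (p a ∧_) (≺-irrefl a)) (∧-zeroʳ (p a)))

rank-injective : ∀ {n} (p : Fin n → Bool) {a b} → p a ≡ true → p b ≡ true →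
                 rank p a ≡ rank p b → a ≡ b
rank-injective p {a} {b} pa pb eq with <-cmp (toℕ a) (toℕ b)
... | tri< lt _ _ = ⊥-elim (<-irrefl eq (rank-strict p {a} {b} pa (<⇒≺ a b lt)))
... | tri≈ _ e _  = toℕ-injective e
... | tri> _ _ gt = ⊥-elim (<-irrefl (sym eq) (rank-strict p {b} {a} pb (<⇒≺ b a gt)))

_≐_ : ∀ {n} → Maybe (Fin n) → Fin n → Bool
just a  ≐ i = does (a ≟ i)
nothing ≐ i = false

≐-sound : ∀ {n} (m : Maybe (Fin n)) {i} → m ≐ i ≡ true → m ≡ just i
≐-sound (just a) {i} h with a ≟ i
... | yes refl = refl

≐-refl : ∀ {n} (a : Fin n) → just a ≐ a ≡ true
≐-refl a with a ≟ a
... | yes _  = refl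
... | no a≢a = ⊥-elim (a≢a refl)

count-≐ : ∀ {n} (m : Maybe (Fin n)) → count (m ≐_) ≡ ind (is-just m)
count-≐ {n} nothing  = count-false {n}
count-≐ (just a) = ≤-antisym (count-atMostOne (just a ≐_) unique) (count-≥1 a (≐-refl a))
  where
  unique : ∀ i j → just a ≐ i ≡ true → just a ≐ j ≡ true → i ≡ j
  unique i j hi hj = just-injective (trans (sym (≐-sound (just a) hi)) (≐-sound (just a) hj))

count₂ : ∀ {m n} → (Fin m → Fin n → Bool) → ℕ
count₂ p = ∑ (λ u → count (p u))

count₂-flip : ∀ {m n} (p : Fin m → Fin n → Bool) → count₂ p ≡ count₂ (λ u v → p v u)
count₂-flip p = ∑-comm (λ u v → ind (p u v))

count-injection : ∀ {n m} (p : Fin n → Bool) (f : Fin n → Maybe (Fin m)) →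
                  (∀ a → p a ≡ true → is-just (f a) ≡ true) →
                  (∀ a b i → p a ≡ true → p b ≡ true → f a ≡ just i → f b ≡ just i → a ≡ b) →
                  count p ≤ m
count-injection {n} {m} p f defined injective = begin
  count p                               ≤⟨ ∑-mono hit-some-colour ⟩
  count₂ (λ a i → p a ∧ (f a ≐ i))      ≡⟨ count₂-flip (λ a i → p a ∧ (f a ≐ i)) ⟩
  count₂ (λ i a → p a ∧ (f a ≐ i))      ≤⟨ ∑-mono (λ i → count-atMostOne _ (one-preimage i)) ⟩
  count {m} (λ _ → true)                ≡⟨ count-true ⟩
  m                                     ∎
  where
  open ≤-Reasoning
  hit-some-colour : ∀ a → ind (p a) ≤ count (λ i → p a ∧ (f a ≐ i))
  hit-some-colour a with p a in pa | f a in fa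
  ... | false | _      = z≤n
  ... | true  | just j = count-≥1 j (≐-refl j)
  ... | true  | nothing with trans (sym (cong is-just fa)) (defined a pa)
  ... | ()
  one-preimage : ∀ i a b → p a ∧ (f a ≐ i) ≡ true → p b ∧ (f b ≐ i) ≡ true → a ≡ b
  one-preimage i a b ha hb =
    injective a b i (∧-elimˡ ha) (∧-elimˡ hb) (≐-sound (f a) (∧-elimʳ ha)) (≐-sound (f b) (∧-elimʳ hb))

_⊆₂_ : ∀ {m n} → (Fin m → Fin n → Bool) → (Fin m → Fin n → Bool) → Set
p ⊆₂ q = ∀ u → p u ⊆ᵇ q u

Disjoint₂ : ∀ {m n} → (Fin m → Fin n → Bool) → (Fin m → Fin n → Bool) → Set
Disjoint₂ p q = ∀ u v → p u v ≡ true → q u v ≡ false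

count₂-mono : ∀ {m n} {p q : Fin m → Fin n → Bool} → p ⊆₂ q → count₂ p ≤ count₂ q
count₂-mono h = ∑-mono (λ u → count-mono (h u))

count₂-∨ : ∀ {m n} (p q : Fin m → Fin n → Bool) →
           count₂ (λ u v → p u v ∨ q u v) ≤ count₂ p + count₂ q
count₂-∨ p q = ≤-trans (∑-mono (λ u → count-∨ (p u) (q u)))
                       (≤-reflexive (∑-distrib-+ (λ u → count (p u)) (λ u → count (q u))))

count₂-disjoint : ∀ {m n} {p q r : Fin m → Fin n → Bool} → p ⊆₂ r → q ⊆₂ r → Disjoint₂ p q →
                  count₂ p + count₂ q ≤ count₂ r
count₂-disjoint {p = p} {q} {r} p⊆r q⊆r disj = begin
  count₂ p + count₂ q               ≡⟨ sym (∑-distrib-+ (λ u → count (p u)) (λ u → count (q u))) ⟩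
  ∑ (λ u → count (p u) + count (q u)) ≤⟨ ∑-mono (λ u → count-disjoint (p u) (q u) (disj u)) ⟩
  count₂ (λ u v → p u v ∨ q u v)    ≤⟨ count₂-mono union⊆r ⟩
  count₂ r                          ∎
  where
  open ≤-Reasoning
  union⊆r : (λ u v → p u v ∨ q u v) ⊆₂ r
  union⊆r u v h with p u v in puv
  ... | true  = p⊆r u v puv
  ... | false = q⊆r u v h

sum-allFin : ∀ {n} (f : Fin n → ℕ) → sum (map f (allFin n)) ≡ ∑ f
sum-allFin {n} f = trans (cong sum (map-tabulate (λ i → i) f)) (sum-tabulate f)
  where
  sum-tabulate : ∀ {k} (g : Fin k → ℕ) → sum (List.tabulate g) ≡ ∑ g
  sum-tabulate {zero}  g = refl
  sum-tabulate {suc k} g = cong (λ s → g zero + s) (sum-tabulate (λ i → g (suc i)))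

countV≡count : ∀ {n} (p : Fin n → Bool) → countV p ≡ count p
countV≡count p = sum-allFin (λ i → ind (p i))

below above : ∀ {n} → (Fin n → Fin n → Bool) → Fin n → Fin n → Bool
below p u v = (u ≺ v) ∧ p u v
above p u v = (v ≺ u) ∧ p u v

countPairs≡ : ∀ {n} (p : Fin n → Fin n → Bool) → countPairs p ≡ count₂ (below p)
countPairs≡ {n} p =
  trans (sum-allFin (λ u → sum (map (λ v → ind ((u ≺ v) ∧ p u v)) (allFin n))))
        (sum-cong-≗ (λ u → sum-allFin (λ v → ind ((u ≺ v) ∧ p u v))))

countPairs-mono : ∀ {n} {p q : Fin n → Fin n → Bool} → p ⊆₂ q → countPairs p ≤ countPairs q
countPairs-mono {p = p} {q} h = begin
  countPairs p      ≡⟨ countPairs≡ p ⟩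
  count₂ (below p)  ≤⟨ count₂-mono (λ u v uv → ∧-intro {u ≺ v} (∧-elimˡ uv) (h u v (∧-elimʳ {u ≺ v} uv))) ⟩
  count₂ (below q)  ≡⟨ sym (countPairs≡ q) ⟩
  countPairs q      ∎
  where open ≤-Reasoning

countPairs-∨ : ∀ {n} (p q : Fin n → Fin n → Bool) →
               countPairs (λ u v → p u v ∨ q u v) ≤ countPairs p + countPairs q
countPairs-∨ p q = begin
  countPairs (λ u v → p u v ∨ q u v)
    ≡⟨ countPairs≡ (λ u v → p u v ∨ q u v) ⟩
  count₂ (below (λ u v → p u v ∨ q u v))
    ≡⟨ sum-cong-≗ (λ u → count-cong (λ v → ∧-distribˡ-∨ (u ≺ v) (p u v) (q u v))) ⟩
  count₂ (λ u v → below p u v ∨ below q u v)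
    ≤⟨ count₂-∨ (below p) (below q) ⟩
  count₂ (below p) + count₂ (below q)
    ≡⟨ sym (cong₂ _+_ (countPairs≡ p) (countPairs≡ q)) ⟩
  countPairs p + countPairs q ∎
  where open ≤-Reasoning

countPairs-disjoint : ∀ {n} {p q r : Fin n → Fin n → Bool} → p ⊆₂ r → q ⊆₂ r → Disjoint₂ p q →
                      countPairs p + countPairs q ≤ countPairs r
countPairs-disjoint {p = p} {q} {r} p⊆r q⊆r disj = begin
  countPairs p + countPairs q          ≡⟨ cong₂ _+_ (countPairs≡ p) (countPairs≡ q) ⟩
  count₂ (below p) + count₂ (below q)  ≤⟨ count₂-disjoint (guard p⊆r) (guard q⊆r) disj′ ⟩
  count₂ (below r)                     ≡⟨ sym (countPairs≡ r) ⟩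
  countPairs r                         ∎
  where
  open ≤-Reasoning
  guard : ∀ {s} → s ⊆₂ r → below s ⊆₂ below r
  guard s⊆r u v h = ∧-intro {u ≺ v} (∧-elimˡ h) (s⊆r u v (∧-elimʳ {u ≺ v} h))
  disj′ : Disjoint₂ (below p) (below q)
  disj′ u v h rewrite disj u v (∧-elimʳ {u ≺ v} h) = ∧-zeroʳ (u ≺ v)

countPairs-converse : ∀ {n} (t : Fin n → Fin n → Bool) →
                      countPairs t + countPairs (λ u v → t v u) ≡ count₂ (below t) + count₂ (above t)
countPairs-converse t =
  cong₂ _+_ (countPairs≡ t) (trans (countPairs≡ (λ u v → t v u)) (count₂-flip (below (λ u v → t v u))))

countPairs-converse≤ : ∀ {n} (t : Fin n → Fin n → Bool) →
                       countPairs t + countPairs (λ u v → t v u) ≤ count₂ t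
countPairs-converse≤ t = begin
  countPairs t + countPairs (λ u v → t v u)  ≡⟨ countPairs-converse t ⟩
  count₂ (below t) + count₂ (above t)
    ≤⟨ count₂-disjoint (λ u v → ∧-elimʳ {u ≺ v}) (λ u v → ∧-elimʳ {v ≺ u}) ordered-apart ⟩
  count₂ t ∎
  where
  open ≤-Reasoning
  ordered-apart : Disjoint₂ (below t) (above t)
  ordered-apart u v h rewrite ≺-asym {u = u} {v} (∧-elimˡ h) = refl

count₂≤countPairs-converse : ∀ {n} (t : Fin n → Fin n → Bool) → (∀ u → t u u ≡ false) →
                             count₂ t ≤ countPairs t + countPairs (λ u v → t v u)
count₂≤countPairs-converse t t-irreflexive = begin
  count₂ t                                    ≤⟨ count₂-mono ordered ⟩
  count₂ (λ u v → below t u v ∨ above t u v)  ≤⟨ count₂-∨ (below t) (above t) ⟩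
  count₂ (below t) + count₂ (above t)         ≡⟨ sym (countPairs-converse t) ⟩
  countPairs t + countPairs (λ u v → t v u)   ∎
  where
  open ≤-Reasoning
  ordered : t ⊆₂ (λ u v → below t u v ∨ above t u v)
  ordered u v h rewrite h | ∧-identityʳ (u ≺ v) | ∧-identityʳ (v ≺ u) = ≺-connex u≢v
    where
    u≢v : ¬ u ≡ v
    u≢v refl with trans (sym h) (t-irreflexive u)
    ... | ()

count₂-asym : ∀ {n} (r : Fin n → Fin n → Bool) → Disjoint₂ r (λ u v → r v u) →
              count₂ r ≤ countPairs (λ u v → r u v ∨ r v u)
count₂-asym r asym =
  ≤-trans (count₂≤countPairs-converse r r-irreflexive)
          (countPairs-disjoint (λ u v h → ∨-introˡ h) (λ u v h → ∨-introʳ {r u v} h) asym)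
  where
  r-irreflexive : ∀ u → r u u ≡ false
  r-irreflexive u with r u u in ruu
  ... | false = refl
  ... | true  = trans (sym ruu) (asym u u ruu)

countPairs-touching : ∀ {n} (e : Fin n → Fin n → Bool) (q : Fin n → Bool) → (∀ u v → e u v ≡ e v u) →
                      countPairs (λ u v → e u v ∧ (q u ∨ q v)) ≤ count₂ (λ u v → q u ∧ e u v)
countPairs-touching e q e-sym = begin
  countPairs (λ u v → e u v ∧ (q u ∨ q v))
    ≤⟨ countPairs-mono from-either-end ⟩
  countPairs (λ u v → (q u ∧ e u v) ∨ (q v ∧ e v u))
    ≤⟨ countPairs-∨ (λ u v → q u ∧ e u v) (λ u v → q v ∧ e v u) ⟩
  countPairs (λ u v → q u ∧ e u v) + countPairs (λ u v → q v ∧ e v u)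
    ≤⟨ countPairs-converse≤ (λ u v → q u ∧ e u v) ⟩
  count₂ (λ u v → q u ∧ e u v) ∎
  where
  open ≤-Reasoning
  from-either-end : (λ u v → e u v ∧ (q u ∨ q v)) ⊆₂ (λ u v → (q u ∧ e u v) ∨ (q v ∧ e v u))
  from-either-end u v h with q u | q v
  ... | true  | _     = ∨-introˡ (∧-elimˡ {e u v} h)
  ... | false | true  = trans (sym (e-sym u v)) (∧-elimˡ {e u v} h)
  ... | false | false with ∧-elimʳ {e u v} {false} h
  ... | ()

any-allFin-intro : ∀ {n} (p : Fin n → Bool) i → p i ≡ true → any p (allFin n) ≡ true
any-allFin-intro p i pi = Equivalence.to T-≡ (any⁺ p (lose (∈-allFin i) (Equivalence.from T-≡ pi)))

any-allFin-elim : ∀ {n} (p : Fin n → Bool) → any p (allFin n) ≡ true → ∃ λ i → p i ≡ true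
any-allFin-elim {n} p h with find (any⁻ p (allFin n) (Equivalence.from T-≡ h))
... | i , _ , pi = i , Equivalence.to T-≡ pi

findᵇ-sound : ∀ {A : Set} (p : A → Bool) (xs : List A) {x} → findᵇ p xs ≡ just x → p x ≡ true
findᵇ-sound p (y ∷ ys) h with p y in py
findᵇ-sound p (y ∷ ys) refl | true = py
... | false = findᵇ-sound p ys h

findᵇ-any : ∀ {A : Set} (p : A → Bool) (xs : List A) → is-just (findᵇ p xs) ≡ any p xs
findᵇ-any p []       = refl
findᵇ-any p (y ∷ ys) with p y
... | true  = refl
... | false = findᵇ-any p ys

findᵇ-cong : ∀ {A : Set} {p q : A → Bool} → (∀ x → p x ≡ q x) → ∀ xs → findᵇ p xs ≡ findᵇ q xs
findᵇ-cong h []       = refl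
findᵇ-cong {p = p} {q} h (y ∷ ys) rewrite h y with q y
... | true  = refl
... | false = findᵇ-cong h ys

⊆ᵇ-or-new : ∀ {n} (p q : Fin n → Bool) → q ⊆ᵇ p ⊎ ∃ λ i → q i ≡ true × p i ≡ false
⊆ᵇ-or-new p q with any? (λ i → (q i ≟ᵇ true) ×-dec (p i ≟ᵇ false))
... | yes new = inj₂ new
... | no none  = inj₁ inside
  where
  inside : q ⊆ᵇ p
  inside i qi with p i in pi
  ... | true  = refl
  ... | false = ⊥-elim (none (i , qi , pi))

-- An inflationary, monotone operator on predicates over Fin n reaches a
-- fixed point within n rounds: every round either is stable or adds an
-- element, and there are only n elements.
module Stabilisation {n} (f : (Fin n → Bool) → (Fin n → Bool))
                     (inflationary : ∀ p → p ⊆ᵇ f p)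
                     (monotone : ∀ {p q} → p ⊆ᵇ q → f p ⊆ᵇ f q) where

  progress : ∀ p k → f (fold p f k) ⊆ᵇ fold p f k ⊎ suc k ≤ count (f (fold p f k))
  progress p k with ⊆ᵇ-or-new (fold p f k) (f (fold p f k))
  ... | inj₁ stable = inj₁ stable
  progress p zero    | inj₂ (i , new , _) = inj₂ (count-≥1 i new)
  progress p (suc k) | inj₂ (i , new , old) with progress p k
  ... | inj₂ grown  = inj₂ (≤-trans (s≤s grown) (count-strict (inflationary _) i new old))
  ... | inj₁ stable with trans (sym old) (monotone stable i new)
  ... | ()

  fixpoint : ∀ p → f (fold p f n) ⊆ᵇ fold p f n
  fixpoint p with progress p n
  ... | inj₁ stable = stable
  ... | inj₂ grown  = ⊥-elim (<-irrefl refl (≤-trans grown (count-≤ _)))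

  fold-inflationary : ∀ p k → p ⊆ᵇ fold p f k
  fold-inflationary p zero    i h = h
  fold-inflationary p (suc k) i h = inflationary _ i (fold-inflationary p k i h)

module Residues (c : ℕ) .{{_ : NonZero c}} where

  residue-inverse : ∀ a x → x < c → ((a + x) % c + (c ∸ a % c)) % c ≡ x
  residue-inverse a x x<c = begin
    ((a + x) % c + d) % c          ≡⟨ %-distribˡ-+ ((a + x) % c) d c ⟩
    ((a + x) % c % c + d % c) % c  ≡⟨ cong (λ r → (r + d % c) % c) (m%n%n≡m%n (a + x) c) ⟩
    ((a + x) % c + d % c) % c      ≡⟨ sym (%-distribˡ-+ (a + x) d c) ⟩
    (a + x + d) % c                ≡⟨ cong (_% c) (shuffle a x d) ⟩
    (x + (a + d)) % c              ≡⟨ %-remove-+ʳ x (divides (suc (a / c)) a+d≡) ⟩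
    x % c                          ≡⟨ m<n⇒m%n≡m x<c ⟩
    x                              ∎
    where
    open ≡-Reasoning
    open ℕ-Solver
    d : ℕ
    d = c ∸ a % c
    shuffle : ∀ a x d → a + x + d ≡ x + (a + d)
    shuffle = solve 3 (λ a x d → a :+ x :+ d := x :+ (a :+ d)) refl
    a+d≡ : a + d ≡ suc (a / c) * c
    a+d≡ = begin
      a + d                        ≡⟨ cong (_+ d) (m≡m%n+[m/n]*n a c) ⟩
      a % c + a / c * c + d        ≡⟨ swap (a % c) (a / c * c) d ⟩
      a % c + d + a / c * c        ≡⟨ cong (_+ a / c * c) (m+[n∸m]≡n (<⇒≤ (m%n<n a c))) ⟩
      c + a / c * c                ∎
      where swap : ∀ r q d → r + q + d ≡ r + d + q
            swap = solve 3 (λ r q d → r :+ q :+ d := r :+ d :+ q) refl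

  +-residue-injective : ∀ a {x y} → x < c → y < c → (a + x) % c ≡ (a + y) % c → x ≡ y
  +-residue-injective a {x} {y} x<c y<c eq =
    trans (sym (residue-inverse a x x<c))
          (trans (cong (λ r → (r + (c ∸ a % c)) % c) eq) (residue-inverse a y y<c))

  diagonal-shift : ∀ l j → l < c → (l + l + ((j + c + c) ∸ (l + l))) % c ≡ j % c
  diagonal-shift l j l<c = begin
    (l + l + ((j + c + c) ∸ (l + l))) % c ≡⟨ cong (_% c) (m+[n∸m]≡n l+l≤) ⟩
    (j + c + c) % c                       ≡⟨ [m+n]%n≡m%n (j + c) c ⟩
    (j + c) % c                           ≡⟨ [m+n]%n≡m%n j c ⟩
    j % c                                 ∎
    where
    open ≡-Reasoning
    l+l≤ : l + l ≤ j + c + c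
    l+l≤ = ≤-trans (+-mono-≤ (<⇒≤ l<c) (<⇒≤ l<c))
                   (≤-trans (m≤n+m (c + c) j) (≤-reflexive (sym (+-assoc j c c))))

budget⇔ : ∀ a e c k → (+ a ℤ.≤ + k ℤ.- + e ℤ.+ + c) ⇔ (a + e ≤ k + c)
budget⇔ a e c k = mk⇔ to from
  where
  open ℤ-Solver
  x : ℤ
  x = + k ℤ.- + e ℤ.+ + c
  x+e : x ℤ.+ + e ≡ + k ℤ.+ + c
  x+e = solve 3 (λ k e c → k :- e :+ c :+ e := k :+ c) refl (+ k) (+ e) (+ c)
  cancel : ∀ i j → i ℤ.+ j ℤ.- j ≡ i
  cancel = solve 2 (λ i j → i :+ j :- j := i) refl
  to : + a ℤ.≤ x → a + e ≤ k + c
  to h = ℤ.drop‿+≤+ (subst₂ ℤ._≤_ (sym (ℤ.pos-+ a e)) (trans x+e (sym (ℤ.pos-+ k c))) (ℤ.+-monoˡ-≤ (+ e) h))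
  from : a + e ≤ k + c → + a ℤ.≤ x
  from h = subst₂ ℤ._≤_ (cancel (+ a) (+ e)) (cancel x (+ e))
             (ℤ.+-monoˡ-≤ (ℤ.- + e) (subst₂ ℤ._≤_ (ℤ.pos-+ a e) (trans (ℤ.pos-+ k c) (sym x+e)) (+≤+ h)))

∈⇒∈ᵇ : ∀ {n} {S : Subset n} {u} → u ∈ S → (u ∈ᵇ S) ≡ true
∈⇒∈ᵇ = []=⇒lookup

∈ᵇ⇒∈ : ∀ {n} {S : Subset n} {u} → (u ∈ᵇ S) ≡ true → u ∈ S
∈ᵇ⇒∈ {S = S} {u} = lookup⇒[]= u S

∈ᵇ-⊤ : ∀ {n} (u : Fin n) → (u ∈ᵇ ⊤) ≡ true
∈ᵇ-⊤ u = lookup-replicate u true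

∈ᵇ-∁ : ∀ {n} (S : Subset n) u → (u ∈ᵇ ∁ S) ≡ not (u ∈ᵇ S)
∈ᵇ-∁ S u = lookup-map u not S

∈ᵇ-∪ : ∀ {n} (S T : Subset n) u → (u ∈ᵇ (S ∪ T)) ≡ (u ∈ᵇ S) ∨ (u ∈ᵇ T)
∈ᵇ-∪ S T u = lookup-zipWith _∨_ u S T

∣∣≡count : ∀ {n} (S : Subset n) → ∣ S ∣ ≡ count (_∈ᵇ S)
∣∣≡count []          = refl
∣∣≡count (true ∷ S)  = cong suc (∣∣≡count S)
∣∣≡count (false ∷ S) = ∣∣≡count S

conn-source : ∀ {G S u w} → Conn G S u w → u ∈ S
conn-source (here uS)     = uS
conn-source (step uS _ _) = uS

conn-mono : ∀ {G S T u w} → S ⊆ T → Conn G S u w → Conn G T u w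
conn-mono S⊆T (here uS)        = here (S⊆T uS)
conn-mono S⊆T (step uS uv vw)  = step (S⊆T uS) uv (conn-mono S⊆T vw)

conn-snoc : ∀ {G S u v w} → Conn G S u v → adj G v w ≡ true → w ∈ S → Conn G S u w
conn-snoc (here vS)      vw wS = step vS vw (here wS)
conn-snoc (step uS ux xv) vw wS = step uS ux (conn-snoc xv vw wS)

-- A component cover of order c with a vertex outside it forces c ≥ 1:
-- that vertex alone is a connected set in G - D.
cover-order-positive : ∀ G {c D v} → OrderComponentCover G c D → v ∉ D → 1 ≤ c
cover-order-positive G {v = v} cover v∉D =
  subst (_≤ _) (∣⁅x⁆∣≡1 v)
    (cover v ⁅ v ⁆ (λ u u∈⁅v⁆ → subst (Conn G _ v) (sym (x∈⁅y⁆⇒x≡y v u∈⁅v⁆)) (here (x∉p⇒x∈∁p v∉D))))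

module Components (G : Graph) (Y : Subset (n G)) where

  grow : (Fin (n G) → Bool) → Fin (n G) → Bool
  grow p w = p w ∨ ((w ∈ᵇ Y) ∧ any (λ v → p v ∧ adj G v w) (allFin (n G)))

  grow-inflationary : ∀ p → p ⊆ᵇ grow p
  grow-inflationary p w pw rewrite pw = refl

  grow-monotone : ∀ {p q} → p ⊆ᵇ q → grow p ⊆ᵇ grow q
  grow-monotone {p} {q} p⊆q w h with p w in pw
  ... | true  = ∨-introˡ (p⊆q w pw)
  ... | false with any-allFin-elim (λ v → p v ∧ adj G v w) (∧-elimʳ {w ∈ᵇ Y} h)
  ... | v , pv∧vw = ∨-introʳ {q w} (∧-intro {w ∈ᵇ Y} (∧-elimˡ h)
                      (any-allFin-intro (λ v → q v ∧ adj G v w) v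
                        (∧-intro {q v} (p⊆q v (∧-elimˡ pv∧vw)) (∧-elimʳ {p v} pv∧vw))))

  open Stabilisation grow grow-inflationary grow-monotone

  component : Fin (n G) → Fin (n G) → Bool
  component u = fold (just u ≐_) grow (n G)

  component-self : ∀ u → component u u ≡ true
  component-self u = fold-inflationary (just u ≐_) (n G) u (≐-refl u)

  component-closed : ∀ {u v w} → component u v ≡ true → w ∈ Y → adj G v w ≡ true →
                     component u w ≡ true
  component-closed {u} {v} {w} uv w∈Y vw =
    fixpoint (just u ≐_) w (∨-introʳ {component u w} (∧-intro (∈⇒∈ᵇ w∈Y)
      (any-allFin-intro (λ x → component u x ∧ adj G x w) v (∧-intro {component u v} uv vw))))

  component-sound : ∀ {u w} → u ∈ Y → component u w ≡ true → Conn G Y u w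
  component-sound {u} u∈Y = rounds-sound (n G) _
    where
    rounds-sound : ∀ k w → fold (just u ≐_) grow k w ≡ true → Conn G Y u w
    rounds-sound zero w h with ≐-sound (just u) h
    ... | refl = here u∈Y
    rounds-sound (suc k) w h with fold (just u ≐_) grow k w in old
    ... | true  = rounds-sound k w old
    ... | false with any-allFin-elim _ (∧-elimʳ {w ∈ᵇ Y} h)
    ... | v , pv∧vw = conn-snoc (rounds-sound k v (∧-elimˡ pv∧vw))
                                (∧-elimʳ {fold (just u ≐_) grow k v} pv∧vw) (∈ᵇ⇒∈ (∧-elimˡ h))

  component-complete : ∀ {u w} → Conn G Y u w → component u w ≡ true
  component-complete {u} = reach (component-self u)
    where
    reach : ∀ {v w} → component u v ≡ true → Conn G Y v w → component u w ≡ true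
    reach uv (here _)          = uv
    reach uv (step _ vx xw)    = reach (component-closed {u} uv (conn-source xw) vx) xw

  component-adjacent : ∀ {u v} → u ∈ Y → v ∈ Y → adj G u v ≡ true →
                       ∀ w → component u w ≡ component v w
  component-adjacent {u} {v} u∈Y v∈Y uv w =
    bool-ext (λ h → component-complete (step v∈Y (trans (Graph.sym G v u) uv) (component-sound u∈Y h)))
             (λ h → component-complete (step u∈Y uv (component-sound v∈Y h)))

  component-size : ∀ {c D} → OrderComponentCover G c D → Y ⊆ ∁ D → ∀ {u} → u ∈ Y →
                   count (component u) ≤ c
  component-size {c} cover Y⊆∁D {u} u∈Y =
    subst (_≤ c) (trans (∣∣≡count T) (count-cong (lookup∘tabulate (component u))))
      (cover u T (λ w w∈T → conn-mono Y⊆∁D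
        (component-sound u∈Y (trans (sym (lookup∘tabulate (component u) w)) (∈⇒∈ᵇ w∈T)))))
    where
    T : Subset (n G)
    T = tabulate (component u)

module Partition {n} (X Y : Subset n) where

  rest : Subset n
  rest = ∁ (X ∪ Y)

  ∈ᵇ-rest : ∀ u → (u ∈ᵇ rest) ≡ not ((u ∈ᵇ X) ∨ (u ∈ᵇ Y))
  ∈ᵇ-rest u = trans (∈ᵇ-∁ (X ∪ Y) u) (cong not (∈ᵇ-∪ X Y u))

  rest⇒∉X : ∀ {u} → (u ∈ᵇ rest) ≡ true → (u ∈ᵇ X) ≡ false
  rest⇒∉X {u} h = neither-left (trans (sym (∈ᵇ-rest u)) h)
    where
    neither-left : ∀ {a b} → not (a ∨ b) ≡ true → a ≡ false
    neither-left {false} _ = refl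

  rest⇒∉Y : ∀ {u} → (u ∈ᵇ rest) ≡ true → (u ∈ᵇ Y) ≡ false
  rest⇒∉Y {u} h = neither-right (trans (sym (∈ᵇ-rest u)) h)
    where
    neither-right : ∀ {a b} → not (a ∨ b) ≡ true → b ≡ false
    neither-right {false} {false} _ = refl

  touchesX : Fin n → Fin n → Bool
  touchesX u v = (u ∈ᵇ X) ∨ (v ∈ᵇ X)

edgeIn-⊤ : ∀ G u v → edgeIn G ⊤ u v ≡ adj G u v
edgeIn-⊤ G u v rewrite ∈ᵇ-⊤ u | ∈ᵇ-⊤ v = refl

edgeIn⇒adj : ∀ G {S u v} → edgeIn G S u v ≡ true → adj G u v ≡ true
edgeIn⇒adj G {S} {u} {v} h = ∧-elimʳ {v ∈ᵇ S} (∧-elimʳ {u ∈ᵇ S} h)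

restrict : ∀ {G S c} → ProperLabeling G ⊤ c → ProperLabeling G S c
restrict {G} {S} ℓ = record
  { L      = L
  ; L-sym  = λ u v e → L-sym u v (to⊤ e)
  ; proper = λ u v w i e₁ e₂ → proper u v w i (to⊤ e₁) (to⊤ e₂)
  }
  where
  open ProperLabeling ℓ
  to⊤ : ∀ {u v} → edgeIn G S u v ≡ true → edgeIn G ⊤ u v ≡ true
  to⊤ {u} {v} e = trans (edgeIn-⊤ G u v) (edgeIn⇒adj G {S} e)

-- Restricting a labeling of G to G - (X ∪ Y) makes
-- the |E(X,V)| edges at X disappear; the weak ones among them were
-- already paid for, and the strong ones number at most c|X| because
-- each vertex has at most c strong edges.
module Restriction (G : Graph) (c : ℕ) (X Y : Subset (n G)) (ℓ : ProperLabeling G ⊤ c) where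
  open ProperLabeling ℓ
  open Partition X Y

  strong : Fin (n G) → Fin (n G) → Bool
  strong u v = adj G u v ∧ is-just (L u v)

  strong-sym : ∀ u v → strong u v ≡ strong v u
  strong-sym u v with adj G u v in uv
  ... | true  rewrite trans (Graph.sym G v u) uv = cong is-just (L-sym u v (trans (edgeIn-⊤ G u v) uv))
  ... | false rewrite trans (Graph.sym G v u) uv = refl

  -- the strong edges at u have distinct colours, so there are at most c of them
  strong-degree : ∀ u → count (strong u) ≤ c
  strong-degree u =
    count-injection (strong u) (L u) (λ v h → ∧-elimʳ {adj G u v} h)
      (λ a b i ha hb → proper u a b i (edge ha) (edge hb))
    where
    edge : ∀ {v} → strong u v ≡ true → edgeIn G ⊤ u v ≡ true
    edge {v} h = trans (edgeIn-⊤ G u v) (∧-elimˡ h)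

  strong-at-X : countPairs (λ u v → strong u v ∧ touchesX u v) ≤ c * ∣ X ∣
  strong-at-X = begin
    countPairs (λ u v → strong u v ∧ touchesX u v) ≤⟨ countPairs-touching strong (_∈ᵇ X) strong-sym ⟩
    count₂ (λ u v → (u ∈ᵇ X) ∧ strong u v)          ≤⟨ ∑-mono per-vertex ⟩
    ∑ (λ u → c * ind (u ∈ᵇ X))                      ≡⟨ sym (*-distribˡ-sum c (λ u → ind (u ∈ᵇ X))) ⟩
    c * count (_∈ᵇ X)                               ≡⟨ cong (c *_) (sym (∣∣≡count X)) ⟩
    c * ∣ X ∣                                        ∎
    where
    open ≤-Reasoning
    per-vertex : ∀ u → count (λ v → (u ∈ᵇ X) ∧ strong u v) ≤ c * ind (u ∈ᵇ X)
    per-vertex u with u ∈ᵇ X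
    ... | true  = ≤-trans (strong-degree u) (≤-reflexive (sym (*-identityʳ c)))
    ... | false = ≤-trans (≤-reflexive (count-false {n G})) z≤n

  weakAtX : ℕ
  weakAtX = countPairs (λ u v → (adj G u v ∧ touchesX u v) ∧ is-nothing (L u v))

  edges-at-X : edgesAt G X ≤ weakAtX + countPairs (λ u v → strong u v ∧ touchesX u v)
  edges-at-X = ≤-trans (countPairs-mono weak-or-strong)
                       (countPairs-∨ (λ u v → (adj G u v ∧ touchesX u v) ∧ is-nothing (L u v))
                                     (λ u v → strong u v ∧ touchesX u v))
    where
    weak-or-strong : (λ u v → adj G u v ∧ touchesX u v) ⊆₂
                     (λ u v → ((adj G u v ∧ touchesX u v) ∧ is-nothing (L u v)) ∨ (strong u v ∧ touchesX u v))
    weak-or-strong u v h with L u v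
    ... | nothing = ∨-introˡ (∧-intro {adj G u v ∧ touchesX u v} h refl)
    ... | just _  = ∨-introʳ {(adj G u v ∧ touchesX u v) ∧ false}
                      (∧-intro {adj G u v ∧ true} (∧-intro {adj G u v} (∧-elimˡ h) refl) (∧-elimʳ {adj G u v} h))

  weak-split : ProperLabeling.weakSize (restrict {S = rest} ℓ) + weakAtX ≤ weakSize
  weak-split = countPairs-disjoint inner⊆ atX⊆ apart
    where
    weakEdge : Fin (n G) → Fin (n G) → Bool
    weakEdge u v = edgeIn G ⊤ u v ∧ is-nothing (L u v)
    inner⊆ : (λ u v → edgeIn G rest u v ∧ is-nothing (L u v)) ⊆₂ weakEdge
    inner⊆ u v h = ∧-intro {edgeIn G ⊤ u v} (trans (edgeIn-⊤ G u v) (edgeIn⇒adj G {rest} (∧-elimˡ h)))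
                           (∧-elimʳ {edgeIn G rest u v} h)
    atX⊆ : (λ u v → (adj G u v ∧ touchesX u v) ∧ is-nothing (L u v)) ⊆₂ weakEdge
    atX⊆ u v h = ∧-intro {edgeIn G ⊤ u v} (trans (edgeIn-⊤ G u v) (∧-elimˡ (∧-elimˡ h)))
                         (∧-elimʳ {adj G u v ∧ touchesX u v} h)
    apart : Disjoint₂ (λ u v → edgeIn G rest u v ∧ is-nothing (L u v))
                      (λ u v → (adj G u v ∧ touchesX u v) ∧ is-nothing (L u v))
    apart u v h rewrite rest⇒∉X {u} (∧-elimˡ (∧-elimˡ h))
                      | rest⇒∉X {v} (∧-elimˡ (∧-elimʳ {u ∈ᵇ rest} (∧-elimˡ h)))
                      | ∧-zeroʳ (adj G u v) = refl

  forward-count : ProperLabeling.weakSize (restrict {S = rest} ℓ) + edgesAt G X ≤ weakSize + c * ∣ X ∣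
  forward-count = begin
    W′ + edgesAt G X                     ≤⟨ +-monoʳ-≤ W′ edges-at-X ⟩
    W′ + (weakAtX + strongAtX)           ≡⟨ sym (+-assoc W′ weakAtX strongAtX) ⟩
    W′ + weakAtX + strongAtX             ≤⟨ +-mono-≤ weak-split strong-at-X ⟩
    weakSize + c * ∣ X ∣                  ∎
    where
    open ≤-Reasoning
    W′ strongAtX : ℕ
    W′ = ProperLabeling.weakSize (restrict {S = rest} ℓ)
    strongAtX = countPairs (λ u v → strong u v ∧ touchesX u v)

pick : ∀ {c} → Bool → Bool → Maybe (Fin c) → Fin c → Maybe (Fin c) → Maybe (Fin c)
pick true  _     old _ _    = old
pick false true  _   x _    = just x
pick false false _   _ rest = rest

data Picked {c} (a b : Bool) (old : Maybe (Fin c)) (x : Fin c) (rest r : Maybe (Fin c)) : Set where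
  first  : a ≡ true → r ≡ old → Picked a b old x rest r
  second : a ≡ false → b ≡ true → r ≡ just x → Picked a b old x rest r
  third  : a ≡ false → b ≡ false → r ≡ rest → Picked a b old x rest r

picked : ∀ {c} a b old (x : Fin c) rest → Picked a b old x rest (pick a b old x rest)
picked true  _     _ _ _ = first refl refl
picked false true  _ _ _ = second refl refl refl
picked false false _ _ _ = third refl refl refl

pick-cong : ∀ {c} {a b} {old old′ : Maybe (Fin c)} {x x′ rest rest′} →
            (a ≡ true → old ≡ old′) → (a ≡ false → b ≡ true → x ≡ x′) →
            (a ≡ false → b ≡ false → rest ≡ rest′) →
            pick a b old x rest ≡ pick a b old′ x′ rest′
pick-cong {a = true}              f _ _ = f refl
pick-cong {a = false} {b = true}  _ g _ = cong just (g refl refl)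
pick-cong {a = false} {b = false} _ _ h = h refl refl

pick-swap : ∀ {c} a b (x y : Fin c) → (a ≡ true → b ≡ false) →
            pick a b (just x) y nothing ≡ pick b a (just y) x nothing
pick-swap true  true  _ _ h with h refl
... | ()
pick-swap true  false _ _ _ = refl
pick-swap false true  _ _ _ = refl
pick-swap false false _ _ _ = refl

-- A labeling ℓ′ of G - (X ∪ Y) extends to G: edges
-- inside a component K of G[Y] get the colours (rank u + rank v + shift K)
-- mod c of a proper edge colouring of the complete graph on |K| ≤ c
-- vertices; the chosen matching edge (x , y), x the first M-neighbour of
-- y, gets colour rank of y among the M-neighbours of x; all other edges
-- at X stay weak.  The shift of K is chosen so that the colour missing at
-- the (unique) matched vertex of K is exactly the colour of its matching
-- edge.
module Extension (G : Graph) (c : ℕ) .{{_ : NonZero c}} (D X Y : Subset (n G))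
  (cover : OrderComponentCover G c D) (X⊆D : X ⊆ D) (Y⊆∁D : Y ⊆ ∁ D)
  (N[Y]⊆X∪Y : ∀ y u → y ∈ Y → adj G y u ≡ true → u ∈ X ∪ Y)
  (M : Fin (n G) → Fin (n G) → Bool)
  (M⊆E : ∀ x y → M x y ≡ true → x ∈ X × y ∈ Y × adj G x y ≡ true)
  (M-degree : ∀ x → x ∈ X → countV (λ y → M x y) ≡ c)
  (M-covers : countV (λ y → any (λ x → M x y) (allFin (n G))) ≡ c * ∣ X ∣)
  (M-separated : ∀ y₁ y₂ → any (λ x → M x y₁) (allFin (n G)) ≡ true →
                           any (λ x → M x y₂) (allFin (n G)) ≡ true →
                           Conn G Y y₁ y₂ → y₁ ≡ y₂)
  where

  open Partition X Y
  open Components G Y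
  open Residues c

  V : Set
  V = Fin (n G)

  X∩Y=∅ : ∀ {u} → (u ∈ᵇ X) ≡ true → (u ∈ᵇ Y) ≡ true → ⊥
  X∩Y=∅ ux uy = x∈∁p⇒x∉p (Y⊆∁D (∈ᵇ⇒∈ uy)) (X⊆D (∈ᵇ⇒∈ ux))

  Y-closed : ∀ {u v} → (u ∈ᵇ Y) ≡ true → adj G u v ≡ true → (v ∈ᵇ X) ≡ false → (v ∈ᵇ Y) ≡ true
  Y-closed {u} {v} uy uv vx with trans (sym (∈ᵇ-∪ X Y v)) (∈⇒∈ᵇ (N[Y]⊆X∪Y u v (∈ᵇ⇒∈ uy) uv))
  ... | v∈X∪Y rewrite vx = v∈X∪Y

  matched : V → Bool
  matched y = any (λ x → M x y) (allFin (n G))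

  partner : V → Maybe V
  partner y = findᵇ (λ x → M x y) (allFin (n G))

  chosen : V → V → Bool
  chosen x y = partner y ≐ x

  chosen⇒M : ∀ {x y} → chosen x y ≡ true → M x y ≡ true
  chosen⇒M {x} {y} h = findᵇ-sound (λ z → M z y) (allFin (n G)) (≐-sound (partner y) h)

  chosen⇒X : ∀ {x y} → chosen x y ≡ true → (x ∈ᵇ X) ≡ true
  chosen⇒X {x} {y} h = ∈⇒∈ᵇ (proj₁ (M⊆E x y (chosen⇒M h)))

  chosen⇒Y : ∀ {x y} → chosen x y ≡ true → (y ∈ᵇ Y) ≡ true
  chosen⇒Y {x} {y} h = ∈⇒∈ᵇ (proj₁ (proj₂ (M⊆E x y (chosen⇒M h))))

  chosen⇒adj : ∀ {x y} → chosen x y ≡ true → adj G x y ≡ true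
  chosen⇒adj {x} {y} h = proj₂ (proj₂ (M⊆E x y (chosen⇒M h)))

  chosen⇒matched : ∀ {x y} → chosen x y ≡ true → matched y ≡ true
  chosen⇒matched {x} {y} h = any-allFin-intro (λ z → M z y) x (chosen⇒M h)

  chosen-asym : Disjoint₂ chosen (λ u v → chosen v u)
  chosen-asym u v h with chosen v u in vu
  ... | false = refl
  ... | true  = ⊥-elim (X∩Y=∅ (chosen⇒X h) (chosen⇒Y vu))

  -- each of the c|X| covered vertices has its own chosen edge
  chosen-count : c * ∣ X ∣ ≤ countPairs (λ u v → chosen u v ∨ chosen v u)
  chosen-count = begin
    c * ∣ X ∣                            ≡⟨ sym M-covers ⟩
    countV matched                       ≡⟨ countV≡count matched ⟩
    ∑ (λ y → ind (matched y))
      ≡⟨ sum-cong-≗ (λ y → cong ind (sym (findᵇ-any (λ x → M x y) (allFin (n G))))) ⟩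
    ∑ (λ y → ind (is-just (partner y)))  ≡⟨ sum-cong-≗ (λ y → sym (count-≐ (partner y))) ⟩
    count₂ (λ y x → chosen x y)          ≡⟨ sym (count₂-flip chosen) ⟩
    count₂ chosen                        ≤⟨ count₂-asym chosen chosen-asym ⟩
    countPairs (λ u v → chosen u v ∨ chosen v u) ∎
    where open ≤-Reasoning

  colour : ℕ → Fin c
  colour k = k mod c

  colour-residue : ∀ k → toℕ (colour k) ≡ k % c
  colour-residue k = toℕ-fromℕ< _

  matchColour : V → V → Fin c
  matchColour x y = colour (rank (M x) y)

  M-rank-< : ∀ {x y} → (x ∈ᵇ X) ≡ true → M x y ≡ true → rank (M x) y < c
  M-rank-< {x} {y} x∈X xy =
    subst (rank (M x) y <_) (trans (sym (countV≡count (M x))) (M-degree x (∈ᵇ⇒∈ x∈X))) (rank-< (M x) xy)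

  matchColour-injective : ∀ {x v w} → (x ∈ᵇ X) ≡ true → M x v ≡ true → M x w ≡ true →
                          matchColour x v ≡ matchColour x w → v ≡ w
  matchColour-injective {x} {v} {w} x∈X xv xw eq = rank-injective (M x) xv xw (begin
    rank (M x) v      ≡⟨ sym (m<n⇒m%n≡m (M-rank-< x∈X xv)) ⟩
    rank (M x) v % c  ≡⟨ trans (sym (colour-residue _)) (trans (cong toℕ eq) (colour-residue _)) ⟩
    rank (M x) w % c  ≡⟨ m<n⇒m%n≡m (M-rank-< x∈X xw) ⟩
    rank (M x) w      ∎)
    where open ≡-Reasoning

  label : V → ℕ
  label u = rank (component u) u

  label-< : ∀ {u} → (u ∈ᵇ Y) ≡ true → label u < c
  label-< {u} u∈Y =
    ≤-trans (rank-< (component u) (component-self u)) (component-size cover Y⊆∁D (∈ᵇ⇒∈ u∈Y))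

  label-adjacent : ∀ {u v} → (u ∈ᵇ Y) ≡ true → (v ∈ᵇ Y) ≡ true → adj G u v ≡ true →
                   label v ≡ rank (component u) v
  label-adjacent {u} {v} u∈Y v∈Y uv =
    rank-cong v (λ w → sym (component-adjacent (∈ᵇ⇒∈ u∈Y) (∈ᵇ⇒∈ v∈Y) uv w))

  -- the matched vertex of the component of u, if any (there is at most one)
  anchor : V → Maybe V
  anchor u = findᵇ (λ w → component u w ∧ matched w) (allFin (n G))

  anchor-adjacent : ∀ {u v} → (u ∈ᵇ Y) ≡ true → (v ∈ᵇ Y) ≡ true → adj G u v ≡ true →
                    anchor u ≡ anchor v
  anchor-adjacent u∈Y v∈Y uv =
    findᵇ-cong (λ w → cong (_∧ matched w) (component-adjacent (∈ᵇ⇒∈ u∈Y) (∈ᵇ⇒∈ v∈Y) uv w))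
               (allFin (n G))

  anchor-self : ∀ {u} → (u ∈ᵇ Y) ≡ true → matched u ≡ true → anchor u ≡ just u
  anchor-self {u} u∈Y mu with anchor u in au
  ... | just m  = cong just (sym (M-separated u m mu (∧-elimʳ {component u m} m-ok)
                                   (component-sound (∈ᵇ⇒∈ u∈Y) (∧-elimˡ m-ok))))
    where
    m-ok : component u m ∧ matched m ≡ true
    m-ok = findᵇ-sound (λ w → component u w ∧ matched w) (allFin (n G)) au
  ... | nothing with trans (sym (cong is-just au))
                          (trans (findᵇ-any (λ w → component u w ∧ matched w) (allFin (n G)))
                                 (any-allFin-intro (λ w → component u w ∧ matched w) u
                                    (∧-intro {component u u} (component-self u) mu)))
  ... | ()

  -- the shift of a component with anchor m puts the colour of m's matching
  -- edge on the diagonal at m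
  shiftFor : Maybe V → ℕ
  shiftFor nothing  = 0
  shiftFor (just m) = (maybe′ (λ x → rank (M x) m) 0 (partner m) + c + c) ∸ (label m + label m)

  shift : V → ℕ
  shift u = shiftFor (anchor u)

  innerColour : V → V → Fin c
  innerColour u v = colour (label u + label v + shift u)

  innerColour-residue : ∀ u v → toℕ (innerColour u v) ≡ (label u + shift u + label v) % c
  innerColour-residue u v = trans (colour-residue _) (cong (_% c) (swap (label u) (label v) (shift u)))
    where
    swap : ∀ a b s → a + b + s ≡ a + s + b
    swap = solve 3 (λ a b s → a :+ b :+ s := a :+ s :+ b) refl
      where open ℕ-Solver

  innerColour-sym : ∀ {u v} → (u ∈ᵇ Y) ≡ true → (v ∈ᵇ Y) ≡ true → adj G u v ≡ true →
                    innerColour u v ≡ innerColour v u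
  innerColour-sym {u} {v} u∈Y v∈Y uv =
    cong colour (cong₂ _+_ (+-comm (label u) (label v)) (cong shiftFor (anchor-adjacent u∈Y v∈Y uv)))

  innerColour-injective : ∀ {u v w} → (u ∈ᵇ Y) ≡ true → (v ∈ᵇ Y) ≡ true → (w ∈ᵇ Y) ≡ true →
                          adj G u v ≡ true → adj G u w ≡ true → innerColour u v ≡ innerColour u w → v ≡ w
  innerColour-injective {u} {v} {w} u∈Y v∈Y w∈Y uv uw eq =
    rank-injective (component u) (component-closed {u} (component-self u) (∈ᵇ⇒∈ v∈Y) uv)
                                 (component-closed {u} (component-self u) (∈ᵇ⇒∈ w∈Y) uw)
      (trans (sym (label-adjacent u∈Y v∈Y uv)) (trans same-label (label-adjacent u∈Y w∈Y uw)))
    where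
    same-label : label v ≡ label w
    same-label = +-residue-injective (label u + shift u) (label-< v∈Y) (label-< w∈Y)
      (trans (sym (innerColour-residue u v)) (trans (cong toℕ eq) (innerColour-residue u w)))

  -- at a matched u ∈ Y the shift is computed from u itself, which puts the
  -- colour of u's matching edge on the diagonal at u
  shift-matched : ∀ {x u} → (u ∈ᵇ Y) ≡ true → chosen x u ≡ true →
                  shift u ≡ (rank (M x) u + c + c) ∸ (label u + label u)
  shift-matched {x} {u} u∈Y xu rewrite anchor-self u∈Y (chosen⇒matched xu) | ≐-sound (partner u) xu = refl

  diagonal : ∀ {x u} → (u ∈ᵇ Y) ≡ true → chosen x u ≡ true →
             (label u + shift u + label u) % c ≡ rank (M x) u % c
  diagonal {x} {u} u∈Y xu = begin
    (label u + shift u + label u) % c  ≡⟨ trans (sym (innerColour-residue u u)) (colour-residue _) ⟩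
    (label u + label u + shift u) % c  ≡⟨ cong (λ s → (label u + label u + s) % c) (shift-matched u∈Y xu) ⟩
    (label u + label u + ((rank (M x) u + c + c) ∸ (label u + label u))) % c
                                       ≡⟨ diagonal-shift (label u) (rank (M x) u) (label-< u∈Y) ⟩
    rank (M x) u % c                   ∎
    where open ≡-Reasoning

  missing-colour : ∀ {x u v} → (u ∈ᵇ Y) ≡ true → chosen x u ≡ true → (v ∈ᵇ Y) ≡ true →
                   adj G u v ≡ true → innerColour u v ≡ matchColour x u → ⊥
  missing-colour {x} {u} {v} u∈Y xu v∈Y uv eq with
    rank-injective (component u) (component-closed {u} (component-self u) (∈ᵇ⇒∈ v∈Y) uv) (component-self u)
      (trans (sym (label-adjacent u∈Y v∈Y uv)) same-label)
    where
    open ≡-Reasoning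
    same-label : label v ≡ label u
    same-label = +-residue-injective (label u + shift u) (label-< v∈Y) (label-< u∈Y) (begin
      (label u + shift u + label v) % c  ≡⟨ sym (innerColour-residue u v) ⟩
      toℕ (innerColour u v)              ≡⟨ cong toℕ eq ⟩
      toℕ (matchColour x u)              ≡⟨ colour-residue _ ⟩
      rank (M x) u % c                   ≡⟨ sym (diagonal u∈Y xu) ⟩
      (label u + shift u + label u) % c  ∎)
  ... | refl with trans (sym uv) (Graph.irrefl G u)
  ... | ()

  rest∌X : ∀ {u} → (u ∈ᵇ rest) ≡ true → (u ∈ᵇ X) ≡ true → ⊥
  rest∌X r x with trans (sym x) (rest⇒∉X r)
  ... | ()

  rest∌Y : ∀ {u} → (u ∈ᵇ rest) ≡ true → (u ∈ᵇ Y) ≡ true → ⊥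
  rest∌Y r y with trans (sym y) (rest⇒∉Y r)
  ... | ()

  -- an edge that is neither inside the rest nor inside Y meets X, since N(Y) ⊆ X ∪ Y
  edge-meets-X : ∀ {u v} → adj G u v ≡ true → (u ∈ᵇ rest) ∧ (v ∈ᵇ rest) ≡ false →
                 (u ∈ᵇ Y) ∧ (v ∈ᵇ Y) ≡ false → touchesX u v ≡ true
  edge-meets-X {u} {v} uv not-rest not-Y with u ∈ᵇ X in ux | v ∈ᵇ X in vx
  ... | true  | _    = refl
  ... | false | true = refl
  ... | false | false =
    ⊥-elim (true≢false (trans (sym (cong₂ _∧_ (in-rest ux u∉Y) (in-rest vx v∉Y))) not-rest))
    where
    in-rest : ∀ {w} → (w ∈ᵇ X) ≡ false → (w ∈ᵇ Y) ≡ false → (w ∈ᵇ rest) ≡ true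
    in-rest {w} wx wy = trans (∈ᵇ-rest w) (cong₂ (λ a b → not (a ∨ b)) wx wy)
    u∉Y : (u ∈ᵇ Y) ≡ false
    u∉Y = ∧≡false⇒ (λ uy → Y-closed uy uv vx) not-Y
    v∉Y : (v ∈ᵇ Y) ≡ false
    v∉Y = ∧≡false⇒ (λ vy → Y-closed vy (trans (Graph.sym G v u) uv) ux)
                   (trans (∧-comm (v ∈ᵇ Y) (u ∈ᵇ Y)) not-Y)

  module Extend (ℓ′ : ProperLabeling G rest c) where
    open ProperLabeling ℓ′ renaming (L to L′; L-sym to L′-sym; proper to L′-proper; weakSize to weak′)

    matchLabel : V → V → Maybe (Fin c)
    matchLabel u v = pick (chosen u v) (chosen v u) (just (matchColour u v)) (matchColour v u) nothing

    L : V → V → Maybe (Fin c)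
    L u v = pick ((u ∈ᵇ rest) ∧ (v ∈ᵇ rest)) ((u ∈ᵇ Y) ∧ (v ∈ᵇ Y))
                 (L′ u v) (innerColour u v) (matchLabel u v)

    L-cases : ∀ u v → Picked ((u ∈ᵇ rest) ∧ (v ∈ᵇ rest)) ((u ∈ᵇ Y) ∧ (v ∈ᵇ Y))
                             (L′ u v) (innerColour u v) (matchLabel u v) (L u v)
    L-cases u v = picked _ _ _ _ _

    edgeIn-rest : ∀ {u v} → (u ∈ᵇ rest) ∧ (v ∈ᵇ rest) ≡ true → adj G u v ≡ true →
                  edgeIn G rest u v ≡ true
    edgeIn-rest {u} r uv = ∧-intro {u ∈ᵇ rest} (∧-elimˡ r) (∧-intro (∧-elimʳ {u ∈ᵇ rest} r) uv)

    adj-of : ∀ {u v} → edgeIn G ⊤ u v ≡ true → adj G u v ≡ true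
    adj-of {u} {v} e = trans (sym (edgeIn-⊤ G u v)) e

    -- each rule is symmetric; the two matching rules exclude each other
    L-symmetric : ∀ u v → edgeIn G ⊤ u v ≡ true → L u v ≡ L v u
    L-symmetric u v e =
      trans (pick-cong (λ r → L′-sym u v (edgeIn-rest r (adj-of e)))
                       (λ _ y → innerColour-sym (∧-elimˡ y) (∧-elimʳ {u ∈ᵇ Y} y) (adj-of e))
                       (λ _ _ → pick-swap (chosen u v) (chosen v u) _ _ (chosen-asym u v)))
            (cong₂ (λ a b → pick a b (L′ v u) (innerColour v u) (matchLabel v u))
                   (∧-comm (u ∈ᵇ rest) (v ∈ᵇ rest)) (∧-comm (u ∈ᵇ Y) (v ∈ᵇ Y)))

    data Strong (u v : V) (i : Fin c) : Set where
      old     : (u ∈ᵇ rest) ≡ true → (v ∈ᵇ rest) ≡ true → L′ u v ≡ just i → Strong u v i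
      inner   : (u ∈ᵇ Y) ≡ true → (v ∈ᵇ Y) ≡ true → innerColour u v ≡ i → Strong u v i
      outward : chosen u v ≡ true → matchColour u v ≡ i → Strong u v i
      inward  : chosen v u ≡ true → matchColour v u ≡ i → Strong u v i

    strong-rule : ∀ {u v i} → L u v ≡ just i → Strong u v i
    strong-rule {u} {v} h with L-cases u v
    ... | first r e    = old (∧-elimˡ r) (∧-elimʳ {u ∈ᵇ rest} r) (trans (sym e) h)
    ... | second _ y e = inner (∧-elimˡ y) (∧-elimʳ {u ∈ᵇ Y} y) (just-injective (trans (sym e) h))
    ... | third _ _ e with picked (chosen u v) (chosen v u) (just (matchColour u v)) (matchColour v u) nothing
    ...   | first ch e′    = outward ch (just-injective (trans (sym e′) (trans (sym e) h)))
    ...   | second _ ch e′ = inward ch (just-injective (trans (sym e′) (trans (sym e) h)))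
    ...   | third _ _ e′ with trans (sym e′) (trans (sym e) h)
    ...     | ()

    -- two strong edges at u with the same colour coincide; mixed rules are
    -- impossible because they put u in two of the disjoint sets X, Y, rest
    L-proper : ∀ u v w (i : Fin c) → edgeIn G ⊤ u v ≡ true → edgeIn G ⊤ u w ≡ true →
               L u v ≡ just i → L u w ≡ just i → v ≡ w
    L-proper u v w i e₁ e₂ h₁ h₂ with strong-rule h₁ | strong-rule h₂
    ... | old ru rv o₁    | old _ rw o₂     = L′-proper u v w i (edgeIn-rest (∧-intro {u ∈ᵇ rest} ru rv) (adj-of e₁))
                                                             (edgeIn-rest (∧-intro {u ∈ᵇ rest} ru rw) (adj-of e₂)) o₁ o₂
    ... | old ru _ _      | inner uy _ _    = ⊥-elim (rest∌Y ru uy)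
    ... | old ru _ _      | outward ch _    = ⊥-elim (rest∌X ru (chosen⇒X ch))
    ... | old ru _ _      | inward ch _     = ⊥-elim (rest∌Y ru (chosen⇒Y ch))
    ... | inner uy _ _    | old ru _ _      = ⊥-elim (rest∌Y ru uy)
    ... | inner uy vy c₁  | inner _ wy c₂   = innerColour-injective uy vy wy (adj-of e₁) (adj-of e₂) (trans c₁ (sym c₂))
    ... | inner uy _ _    | outward ch _    = ⊥-elim (X∩Y=∅ (chosen⇒X ch) uy)
    ... | inner uy vy c₁  | inward ch c₂    = ⊥-elim (missing-colour uy ch vy (adj-of e₁) (trans c₁ (sym c₂)))
    ... | outward ch _    | old ru _ _      = ⊥-elim (rest∌X ru (chosen⇒X ch))
    ... | outward ch _    | inner uy _ _    = ⊥-elim (X∩Y=∅ (chosen⇒X ch) uy)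
    ... | outward ch₁ c₁  | outward ch₂ c₂  = matchColour-injective (chosen⇒X ch₁) (chosen⇒M ch₁) (chosen⇒M ch₂)
                                                                   (trans c₁ (sym c₂))
    ... | outward ch₁ _   | inward ch₂ _    = ⊥-elim (X∩Y=∅ (chosen⇒X ch₁) (chosen⇒Y ch₂))
    ... | inward ch _     | old ru _ _      = ⊥-elim (rest∌Y ru (chosen⇒Y ch))
    ... | inward ch c₁    | inner uy wy c₂  = ⊥-elim (missing-colour uy ch wy (adj-of e₂) (trans c₂ (sym c₁)))
    ... | inward ch₁ _    | outward ch₂ _   = ⊥-elim (X∩Y=∅ (chosen⇒X ch₂) (chosen⇒Y ch₁))
    ... | inward ch₁ _    | inward ch₂ _    = just-injective (trans (sym (≐-sound (partner u) ch₁))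
                                                                    (≐-sound (partner u) ch₂))

    ℓ : ProperLabeling G ⊤ c
    ℓ = record { L = L ; L-sym = L-symmetric ; proper = L-proper }

    weak-edges : (λ u v → edgeIn G ⊤ u v ∧ is-nothing (L u v)) ⊆₂
                 (λ u v → (edgeIn G rest u v ∧ is-nothing (L′ u v)) ∨
                          ((adj G u v ∧ touchesX u v) ∧ is-nothing (L u v)))
    weak-edges u v h with L-cases u v
    ... | first r e    = ∨-introˡ (∧-intro {edgeIn G rest u v} (edgeIn-rest r uv)
                                           (trans (cong is-nothing (sym e)) (∧-elimʳ {edgeIn G ⊤ u v} h)))
      where uv = adj-of (∧-elimˡ h)
    ... | second _ _ e = ⊥-elim (true≢false (trans (sym (∧-elimʳ {edgeIn G ⊤ u v} h)) (cong is-nothing e)))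
    ... | third r y _  = ∨-introʳ {edgeIn G rest u v ∧ is-nothing (L′ u v)}
                           (∧-intro {adj G u v ∧ touchesX u v} (∧-intro {adj G u v} uv (edge-meets-X uv r y))
                                    (∧-elimʳ {edgeIn G ⊤ u v} h))
      where uv = adj-of (∧-elimˡ h)

    chosen-at-X : (λ u v → chosen u v ∨ chosen v u) ⊆₂ (λ u v → adj G u v ∧ touchesX u v)
    chosen-at-X u v h with chosen u v in uv
    ... | true  = ∧-intro {adj G u v} (chosen⇒adj uv) (∨-introˡ (chosen⇒X uv))
    ... | false = ∧-intro {adj G u v} (trans (Graph.sym G u v) (chosen⇒adj h)) (∨-introʳ {u ∈ᵇ X} (chosen⇒X h))

    X-end : ∀ {u v} → chosen u v ∨ chosen v u ≡ true → (u ∈ᵇ X) ≡ true ⊎ (v ∈ᵇ X) ≡ true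
    X-end {u} {v} h with chosen u v in uv
    ... | true  = inj₁ (chosen⇒X uv)
    ... | false = inj₂ (chosen⇒X h)

    chosen-strong : ∀ {u v} → chosen u v ∨ chosen v u ≡ true → is-nothing (L u v) ≡ false
    chosen-strong {u} {v} h with L-cases u v | X-end h
    ... | first r _    | inj₁ ux = ⊥-elim (rest∌X (∧-elimˡ r) ux)
    ... | first r _    | inj₂ vx = ⊥-elim (rest∌X (∧-elimʳ {u ∈ᵇ rest} r) vx)
    ... | second _ _ e | _       = cong is-nothing e
    ... | third _ _ e  | _ with picked (chosen u v) (chosen v u) (just (matchColour u v)) (matchColour v u) nothing
    ...   | first _ e′    = cong is-nothing (trans e e′)
    ...   | second _ _ e′ = cong is-nothing (trans e e′)
    ...   | third ¬uv ¬vu _ = ⊥-elim (true≢false (trans (sym h) (cong₂ _∨_ ¬uv ¬vu)))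

    weakAtX : ℕ
    weakAtX = countPairs (λ u v → (adj G u v ∧ touchesX u v) ∧ is-nothing (L u v))

    chosenEdges : ℕ
    chosenEdges = countPairs (λ u v → chosen u v ∨ chosen v u)

    at-X : weakAtX + chosenEdges ≤ edgesAt G X
    at-X = countPairs-disjoint (λ u v → ∧-elimˡ {adj G u v ∧ touchesX u v}) chosen-at-X apart
      where
      apart : Disjoint₂ (λ u v → (adj G u v ∧ touchesX u v) ∧ is-nothing (L u v))
                        (λ u v → chosen u v ∨ chosen v u)
      apart u v h with chosen u v ∨ chosen v u in ch
      ... | false = refl
      ... | true  =
        ⊥-elim (true≢false (trans (sym (∧-elimʳ {adj G u v ∧ touchesX u v} h)) (chosen-strong ch)))

    backward-count : ProperLabeling.weakSize ℓ + c * ∣ X ∣ ≤ weak′ + edgesAt G X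
    backward-count = begin
      ProperLabeling.weakSize ℓ + c * ∣ X ∣ ≤⟨ +-mono-≤ weak-bound chosen-count ⟩
      weak′ + weakAtX + chosenEdges         ≡⟨ +-assoc weak′ weakAtX chosenEdges ⟩
      weak′ + (weakAtX + chosenEdges)       ≤⟨ +-monoʳ-≤ weak′ at-X ⟩
      weak′ + edgesAt G X                   ∎
      where
      open ≤-Reasoning
      weak-bound : ProperLabeling.weakSize ℓ ≤ weak′ + weakAtX
      weak-bound = ≤-trans (countPairs-mono weak-edges)
                           (countPairs-∨ (λ u v → edgeIn G rest u v ∧ is-nothing (L′ u v))
                                         (λ u v → (adj G u v ∧ touchesX u v) ∧ is-nothing (L u v)))

proposition15 :
    (G : Graph) (c k : ℕ) (D X Y : Subset (n G)) →
    OrderComponentCover G c D →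
    Saturated G D →
    (∀ v → v ∉ D → ∃ λ u → u ∈ D × Conn G ⊤ v u) →
    ∣ ∁ D ∣ ≥ c * c * ∣ D ∣ →
    X ⊆ D → Y ⊆ ∁ D → Nonempty X → Nonempty Y →
    (∀ y u → y ∈ Y → adj G y u ≡ true → u ∈ X ∪ Y) →
    (Σ (Fin (n G) → Fin (n G) → Bool) λ M →
      (∀ x y → M x y ≡ true → x ∈ X × y ∈ Y × adj G x y ≡ true) ×
      (∀ x → x ∈ X → countV (λ y → M x y) ≡ c) ×
      (countV (λ y → any (λ x → M x y) (allFin (n G))) ≡ c * ∣ X ∣) ×
      (∀ y₁ y₂ → any (λ x → M x y₁) (allFin (n G)) ≡ true →
                 any (λ x → M x y₂) (allFin (n G)) ≡ true →
                 Conn G Y y₁ y₂ → y₁ ≡ y₂)) →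
    ECSYes G ⊤ c (+ k) ⇔
      ECSYes G (∁ (X ∪ Y)) c (+ k ℤ.- + edgesAt G X ℤ.+ + (c * ∣ X ∣))
proposition15 G c k D X Y cover _ _ _ X⊆D Y⊆∁D _ (y , y∈Y) N[Y]⊆X∪Y
              (M , M⊆E , M-degree , M-covers , M-separated) =
  mk⇔ restrict-solution extend-solution
  where
  reduced-budget : ℤ
  reduced-budget = + k ℤ.- + edgesAt G X ℤ.+ + (c * ∣ X ∣)

  restrict-solution : ECSYes G ⊤ c (+ k) → ECSYes G (∁ (X ∪ Y)) c reduced-budget
  restrict-solution (ℓ , ℓ≤k) =
    restrict ℓ , Equivalence.from (budget⇔ _ (edgesAt G X) (c * ∣ X ∣) k)
                   (≤-trans forward-count (+-monoˡ-≤ (c * ∣ X ∣) (ℤ.drop‿+≤+ ℓ≤k)))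
    where open Restriction G c X Y ℓ

  extend-solution : ECSYes G (∁ (X ∪ Y)) c reduced-budget → ECSYes G ⊤ c (+ k)
  extend-solution (ℓ′ , ℓ′≤) =
    ℓ , +≤+ (+-cancelʳ-≤ (c * ∣ X ∣) _ k
               (≤-trans backward-count (Equivalence.to (budget⇔ _ (edgesAt G X) (c * ∣ X ∣) k) ℓ′≤)))
    where
    open Extension G c {{>-nonZero (cover-order-positive G cover (x∈∁p⇒x∉p (Y⊆∁D y∈Y)))}} D X Y
                   cover X⊆D Y⊆∁D N[Y]⊆X∪Y M M⊆E M-degree M-covers M-separated
    open Extend ℓ′
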